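{- Let $q\ge3$, $n\ge1$, and let $(T_+,T_-)$ be a pair of disjoint subsets of $\mathbb{Z}_q^n$ such that $w_{T_+}(x)=w_{T_- }(x)\le1$ for every vertex $x$ of $H(n,q)$. Then any two distinct elements of $T_+$ are at Hamming distance at least $4$, and the same holds for $T_-$.
   Context: $H(n,q)$ is the Hamming graph on $\mathbb{Z}_q^n$ (adjacent iff differing in exactly one coordinate), $d$ the Hamming distance, $S_i(x)=\{y:d(x,y)=i\}$. For $Z\subseteq\mathbb{Z}_q^n$, $w_Z(x)=|S_0(x)\cap Z|+|S_1(x)\cap Z|+\frac{2}{n}|S_2(x)\cap Z|$. -}

module Defs where

open import Data.Nat using (ℕ; zero; suc; NonZero)
open import Data.Fin using (Fin)
open import Data.Fin.Properties using (_≟_)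
open import Data.Vec using (Vec; []; _∷_)
open import Data.List using (List; []; _∷_; map; concatMap; filter; length)
open import Data.List.Base using (allFin)
open import Data.Bool using (Bool; true; false)
open import Data.Integer using (+_)
open import Data.Rational using (ℚ; _+_; _*_; _/_)
import Data.Nat as ℕ
open import Relation.Nullary using (does)
open import Relation.Binary.PropositionalEquality using (_≡_)
open import Relation.Nullary.Decidable using (yes; no)

Word : ℕ → ℕ → Set
Word n q = Vec (Fin q) n

hamming : ∀ {n q} → Word n q → Word n q → ℕ
hamming [] [] = 0
hamming (a ∷ x) (b ∷ y) with a ≟ b
... | yes _ = hamming x y
... | no  _ = suc (hamming x y)

allWords : (n q : ℕ) → List (Word n q)
allWords zero q = [] ∷ []
allWords (suc n) q = concatMap (λ a → map (a ∷_) (allWords n q)) (allFin q)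

Subset : ℕ → ℕ → Set
Subset n q = Word n q → Bool

_∈Z_ : ∀ {n q} → Word n q → Subset n q → Set
x ∈Z Z = Z x ≡ true

sphereCount : ∀ {n q} → Subset n q → ℕ → Word n q → ℕ
sphereCount {n} {q} Z i x =
  length (filter (λ y → ℕ._≟_ (hamming x y) i) (filter (λ y → Data.Bool._≟_ (Z y) true) (allWords n q)))

w : ∀ {n q} → .{{NonZero n}} → Subset n q → Word n q → ℚ
w {n} Z x =
  ((+ sphereCount Z 0 x) / 1) + ((+ sphereCount Z 1 x) / 1)
    + ((+ 2) / n) * ((+ sphereCount Z 2 x) / 1)

Disjoint : ∀ {n q} → Subset n q → Subset n q → Set
Disjoint {n} {q} A B = ∀ (x : Word n q) → x ∈Z A → x ∈Z B → Data.Empty.⊥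
  where import Data.Empty

-- If two points of Z were at distance 1, 2 or 3, some vertex would see points of Z in two of its
-- spheres S₀, S₁, S₂: the closer point itself for distance 1 and 2, a neighbour of it on a geodesic
-- towards the other point for distance 3. Each occupied sphere among S₀, S₁ contributes at least 1
-- to the weight and an occupied S₂ contributes a positive amount, so that vertex would have weight
-- above 1. Hence the bound w ≤ 1 alone forces minimum distance 4, for T₊ and T₋ separately.
module Submission where

open import Defs
open import Data.Nat using (ℕ; suc; _≤_; _≥_; s≤s; z≤n; NonZero)
import Data.Nat as ℕ
open import Data.Nat.Properties using (suc-injective; ≮⇒≥)
import Data.Nat.Coprimality as Coprimality
open import Data.Product using (_×_; _,_; proj₁; proj₂; ∃-syntax)
open import Data.Rational using (0ℚ; 1ℚ; _/_; _<_; _*_; *≤*; *<*) renaming (_≤_ to _≤ℚ_)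
open import Data.Rational.Properties
  using ( normalize-coprime; normalize-nonNeg; normalize-pos; nonNegative⁻¹; positive⁻¹
        ; nonNeg*nonNeg⇒nonNeg; pos*pos⇒pos; +-mono-≤; +-mono-<-≤; +-mono-≤-<
        ; <-≤-trans; <-irrefl)
open import Data.Integer using (+_; +≤+; +<+)
open import Data.Fin using (Fin)
open import Data.Fin.Properties using (_≟_)
open import Data.Vec using (_∷_; [])
open import Data.List using (List; _∷_; map; length)
open import Data.List.Membership.Propositional using (_∈_)
open import Data.List.Membership.Propositional.Properties
  using (∈-filter⁺; ∈-map⁺; ∈-concatMap⁺; ∈-allFin)
import Data.List.Relation.Unary.Any as Any
open import Data.Bool using (true)
import Data.Bool as Bool
open import Data.Empty using (⊥-elim)
open import Function using (_∘_)
open import Relation.Binary.PropositionalEquality using (_≡_; _≢_; refl; sym; trans; cong; subst)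
open import Relation.Nullary using (yes; no; ¬_)

1≤[m]/1 : ∀ {m} → 1 ≤ m → 1ℚ ≤ℚ (+ m) / 1
1≤[m]/1 {suc k} _
  rewrite normalize-coprime {suc k} {0} (Coprimality.sym (Coprimality.1-coprimeTo (suc k)))
  = *≤* (+≤+ (s≤s z≤n))

0≤[m]/1 : ∀ m → 0ℚ ≤ℚ (+ m) / 1
0≤[m]/1 m = nonNegative⁻¹ ((+ m) / 1) {{normalize-nonNeg m 1}}

0≤[2/t]*[m]/1 : ∀ t .{{_ : NonZero t}} m → 0ℚ ≤ℚ ((+ 2) / t) * ((+ m) / 1)
0≤[2/t]*[m]/1 t m = nonNegative⁻¹ (((+ 2) / t) * ((+ m) / 1))
  {{nonNeg*nonNeg⇒nonNeg ((+ 2) / t) {{normalize-nonNeg 2 t}} ((+ m) / 1) {{normalize-nonNeg m 1}}}}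

0<[2/t]*[m]/1 : ∀ t .{{_ : NonZero t}} {m} → 1 ≤ m → 0ℚ < ((+ 2) / t) * ((+ m) / 1)
0<[2/t]*[m]/1 t {suc k} _ = positive⁻¹ (((+ 2) / t) * ((+ suc k) / 1))
  {{pos*pos⇒pos ((+ 2) / t) {{normalize-pos 2 t}} ((+ suc k) / 1) {{normalize-pos (suc k) 1}}}}

<⇒≱ : ∀ {p r} → p < r → ¬ (r ≤ℚ p)
<⇒≱ {p} {r} p<r r≤p = <-irrefl {p} {p} refl (<-≤-trans {p} {r} {p} p<r r≤p)

data Crowded {n q : ℕ} (Z : Subset n q) (x : Word n q) : Set where
  S₀∧S₁ : 1 ≤ sphereCount Z 0 x → 1 ≤ sphereCount Z 1 x → Crowded Z x
  S₀∧S₂ : 1 ≤ sphereCount Z 0 x → 1 ≤ sphereCount Z 2 x → Crowded Z x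
  S₁∧S₂ : 1 ≤ sphereCount Z 1 x → 1 ≤ sphereCount Z 2 x → Crowded Z x

crowded⇒1<w : ∀ {n q} .{{_ : NonZero n}} (Z : Subset n q) (x : Word n q) →
              Crowded Z x → 1ℚ < w Z x
crowded⇒1<w {n} Z x (S₀∧S₁ s₀ s₁) =
  +-mono-<-≤ {1ℚ} {_} {0ℚ}
    (+-mono-≤-< {1ℚ} {_} {0ℚ} (1≤[m]/1 s₀) (<-≤-trans {0ℚ} {1ℚ} (*<* (+<+ (s≤s z≤n))) (1≤[m]/1 s₁)))
    (0≤[2/t]*[m]/1 n (sphereCount Z 2 x))
crowded⇒1<w {n} Z x (S₀∧S₂ s₀ s₂) =
  +-mono-≤-< (+-mono-≤ (1≤[m]/1 s₀) (0≤[m]/1 (sphereCount Z 1 x))) (0<[2/t]*[m]/1 n s₂)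
crowded⇒1<w {n} Z x (S₁∧S₂ s₁ s₂) =
  +-mono-≤-< (+-mono-≤ (0≤[m]/1 (sphereCount Z 0 x)) (1≤[m]/1 s₁)) (0<[2/t]*[m]/1 n s₂)

∈-allWords : ∀ {n q} (x : Word n q) → x ∈ allWords n q
∈-allWords [] = Any.here refl
∈-allWords {suc n} {q} (a ∷ x) =
  ∈-concatMap⁺ (λ b → map (b ∷_) (allWords n q))
    (Any.map (λ { refl → ∈-map⁺ (a ∷_) (∈-allWords x) }) (∈-allFin a))

1≤length : ∀ {A : Set} {a : A} {as : List A} → a ∈ as → 1 ≤ length as
1≤length {as = _ ∷ _} _ = s≤s z≤n

1≤sphereCount : ∀ {n q} (Z : Subset n q) i (x y : Word n q) →
                y ∈Z Z → hamming x y ≡ i → 1 ≤ sphereCount Z i x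
1≤sphereCount Z i x y y∈Z d≡i =
  1≤length (∈-filter⁺ (λ v → ℕ._≟_ (hamming x v) i)
             (∈-filter⁺ (λ v → Bool._≟_ (Z v) true) (∈-allWords y) y∈Z) d≡i)

hamming-cons-≡ : ∀ {n q} (a : Fin q) (x y : Word n q) → hamming (a ∷ x) (a ∷ y) ≡ hamming x y
hamming-cons-≡ a x y with a ≟ a
... | yes _  = refl
... | no a≢a = ⊥-elim (a≢a refl)

hamming-cons-≢ : ∀ {n q} {a b : Fin q} (x y : Word n q) → a ≢ b →
                 hamming (a ∷ x) (b ∷ y) ≡ suc (hamming x y)
hamming-cons-≢ {a = a} {b} x y a≢b with a ≟ b
... | yes a≡b = ⊥-elim (a≢b a≡b)
... | no _    = refl

hamming-refl : ∀ {n q} (x : Word n q) → hamming x x ≡ 0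
hamming-refl []      = refl
hamming-refl (a ∷ x) rewrite hamming-cons-≡ a x x = hamming-refl x

hamming≡0⇒≡ : ∀ {n q} (x y : Word n q) → hamming x y ≡ 0 → x ≡ y
hamming≡0⇒≡ [] [] _ = refl
hamming≡0⇒≡ (a ∷ x) (b ∷ y) d≡0 with a ≟ b
... | yes refl = cong (a ∷_) (hamming≡0⇒≡ x y d≡0)
... | no _ with () ← d≡0

-- Walking one step from x towards y: change the first coordinate in which they differ.
hamming-suc⇒step : ∀ {n q} (x y : Word n q) {k} → hamming x y ≡ suc k →
                   ∃[ z ] hamming z x ≡ 1 × hamming z y ≡ k
hamming-suc⇒step [] [] ()
hamming-suc⇒step (a ∷ x) (b ∷ y) d≡1+k with a ≟ b
... | yes refl =
  let z , zx≡1 , zy≡k = hamming-suc⇒step x y d≡1+k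
  in a ∷ z , trans (hamming-cons-≡ a z x) zx≡1 , trans (hamming-cons-≡ a z y) zy≡k
... | no a≢b =
  b ∷ x , trans (hamming-cons-≢ x x (a≢b ∘ sym)) (cong suc (hamming-refl x))
        , trans (hamming-cons-≡ b x y) (suc-injective d≡1+k)

close-pair⇒crowded : ∀ {n q} (Z : Subset n q) (x y : Word n q) → x ∈Z Z → y ∈Z Z → x ≢ y →
                     hamming x y ℕ.< 4 → ∃[ v ] Crowded Z v
close-pair⇒crowded Z x y x∈Z y∈Z x≢y d<4 with hamming x y in d
... | 0 = ⊥-elim (x≢y (hamming≡0⇒≡ x y d))
... | 1 = x , S₀∧S₁ (1≤sphereCount Z 0 x x x∈Z (hamming-refl x)) (1≤sphereCount Z 1 x y y∈Z d)
... | 2 = x , S₀∧S₂ (1≤sphereCount Z 0 x x x∈Z (hamming-refl x)) (1≤sphereCount Z 2 x y y∈Z d)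
... | 3 with z , zx≡1 , zy≡2 ← hamming-suc⇒step x y d =
  z , S₁∧S₂ (1≤sphereCount Z 1 z x x∈Z zx≡1) (1≤sphereCount Z 2 z y y∈Z zy≡2)
... | suc (suc (suc (suc _))) with s≤s (s≤s (s≤s (s≤s ()))) ← d<4

w≤1⇒distance≥4 : ∀ {n q} .{{_ : NonZero n}} (Z : Subset n q) → (∀ v → w Z v ≤ℚ 1ℚ) →
                 ∀ (x y : Word n q) → x ∈Z Z → y ∈Z Z → x ≢ y → hamming x y ≥ 4
w≤1⇒distance≥4 Z w≤1 x y x∈Z y∈Z x≢y = ≮⇒≥ λ d<4 →
  let v , crowded = close-pair⇒crowded Z x y x∈Z y∈Z x≢y d<4
  in <⇒≱ (crowded⇒1<w Z v crowded) (w≤1 v)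

lemma2 : (q n : ℕ) → q ≥ 3 → .{{_ : NonZero n}} →
    (T₊ T₋ : Subset n q) → Disjoint T₊ T₋ →
    (∀ (x : Word n q) → (w T₊ x ≡ w T₋ x) × (w T₊ x ≤ℚ 1ℚ)) →
    (∀ (x y : Word n q) → x ∈Z T₊ → y ∈Z T₊ → x ≢ y → hamming x y ≥ 4) ×
    (∀ (x y : Word n q) → x ∈Z T₋ → y ∈Z T₋ → x ≢ y → hamming x y ≥ 4)
lemma2 q n _ T₊ T₋ _ balanced =
  w≤1⇒distance≥4 T₊ (λ x → proj₂ (balanced x)) ,
  w≤1⇒distance≥4 T₋ (λ x → subst (_≤ℚ 1ℚ) (proj₁ (balanced x)) (proj₂ (balanced x)))
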